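{- The number of distinct maximum genus embeddings of the complete graph $K_7$ is at least $49766400000$.
   Context: Embeddings are orientable cellular embeddings of the labeled graph, identified with rotation systems (a cyclic order of the incident edges at each vertex); two embeddings are distinct if their rotation systems differ. A maximum genus embedding is one in an orientable surface of genus equal to the maximum genus of the graph. -}

module Defs where

open import Data.Nat using (ℕ; zero; suc; _+_; _*_; _∸_; _<_; _≤_; _≤ᵇ_; _/_)
open import Data.Fin using (Fin; toℕ)
open import Data.Fin.Properties using () renaming (_≟_ to _≟ᶠ_)
open import Data.Bool using (Bool; _∧_; not; true)
open import Data.List using (List; map; concatMap; allFin; upTo; length; filterᵇ; _∷_; [])
open import Data.Product using (_×_; _,_; ∃; Σ)
open import Relation.Binary.PropositionalEquality using (_≡_; _≢_)
open import Relation.Nullary.Decidable using (⌊_⌋)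

-- Complete graph K_n on vertex set Fin n (every pair of distinct vertices adjacent).
-- A rotation system is given by a local rotation ρ u : Fin n → Fin n at each
-- vertex u: ρ u v is the neighbour following v in the cyclic order at u.
RotSys : ℕ → Set
RotSys n = Fin n → Fin n → Fin n

iter : {A : Set} → (A → A) → ℕ → A → A
iter f zero    x = x
iter f (suc k) x = f (iter f k x)

record IsRotationSystem (n : ℕ) (ρ : RotSys n) : Set where
  field
    fixes-centre : ∀ u → ρ u u ≡ u
    neighbours   : ∀ u v → v ≢ u → ρ u v ≢ u
    one-cycle    : ∀ u v w → v ≢ u → w ≢ u →
                   ∃ λ k → (k < n ∸ 1) × (iter (ρ u) k v ≡ w)

allᵇ : {A : Set} → (A → Bool) → List A → Bool
allᵇ p []       = true
allᵇ p (x ∷ xs) = p x ∧ allᵇ p xs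

Dart : ℕ → Set
Dart n = Fin n × Fin n

allPairs : (n : ℕ) → List (Dart n)
allPairs n = concatMap (λ u → map (λ v → (u , v)) (allFin n)) (allFin n)

isDart : {n : ℕ} → Dart n → Bool
isDart (u , v) = not ⌊ u ≟ᶠ v ⌋

faceStep : {n : ℕ} → RotSys n → Dart n → Dart n
faceStep ρ (u , v) = (v , ρ v u)

key : {n : ℕ} → Dart n → ℕ
key {n} (u , v) = toℕ u * n + toℕ v

-- A dart is the leader of its face if it has the least key along its orbit
-- (orbits have length ≤ n*n, so n*n iterations traverse the whole face).
isLeader : {n : ℕ} → RotSys n → Dart n → Bool
isLeader {n} ρ d = allᵇ (λ k → key d ≤ᵇ key (iter (faceStep ρ) k d)) (upTo (n * n))

faces : (n : ℕ) → RotSys n → ℕ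
faces n ρ = length (filterᵇ (λ d → isDart d ∧ isLeader ρ d) (allPairs n))

edgesK : ℕ → ℕ
edgesK n = (n * (n ∸ 1)) / 2

-- Genus from Euler's formula V - E + F = 2 - 2g.
genus : (n : ℕ) → RotSys n → ℕ
genus n ρ = (2 + edgesK n ∸ (n + faces n ρ)) / 2

IsMaxGenusEmbedding : (n : ℕ) → RotSys n → Set
IsMaxGenusEmbedding n ρ =
  IsRotationSystem n ρ × (∀ ρ' → IsRotationSystem n ρ' → genus n ρ' ≤ genus n ρ)

SameRot : {n : ℕ} → RotSys n → RotSys n → Set
SameRot ρ ρ' = ∀ u v → ρ u v ≡ ρ' u v

module Submission where

open import Defs
open import Data.Bool using (Bool; true; false; T; not; _∧_; _∨_)
open import Data.Bool.ListAction using (all; any)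
open import Data.Bool.Properties using (T-∧; T-∨; T-≡; T-not-≡)
open import Data.Empty using (⊥-elim)
open import Data.Fin using (Fin; zero; suc; toℕ; fromℕ<; #_; punchIn; punchOut; combine; remQuot; inject≤)
open import Data.Fin.Properties
  using (_≟_; all?; pigeonhole; toℕ<n; toℕ≤pred[n]; toℕ-injective; toℕ-fromℕ<; toℕ-combine; remQuot-combine;
         combine-remQuot; injective⇒≤; inject≤-injective; suc-injective;
         punchIn-injective; punchInᵢ≢i; punchOut-injective; punchOut-cong; punchOut-punchIn; punchIn-punchOut)
open import Data.List using (List; []; _∷_; _++_; map; concatMap; cartesianProduct; length; lookup; filterᵇ; allFin; upTo)
open import Data.List.Membership.Propositional using (_∈_; lose)
open import Data.List.Membership.Propositional.Properties
  using (∈-lookup; ∈-filter⁺; ∈-filter⁻; ∈-upTo⁺; ∈-allFin; ∈-cartesianProduct⁺)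
open import Data.List.Relation.Unary.All as All using (All)
open import Data.List.Relation.Unary.All.Properties using (all⁺; all⁻)
open import Data.List.Relation.Unary.Any using (here; there; satisfied)
open import Data.List.Relation.Unary.Any.Properties using (any⁺; any⁻)
open import Data.List.Relation.Unary.AllPairs using (_∷_; allPairs?)
open import Data.List.Relation.Unary.Unique.Propositional using (Unique)
open import Data.List.Relation.Unary.Unique.Propositional.Properties using (filter⁺; cartesianProduct⁺; allFin⁺)
open import Data.Nat using (ℕ; zero; suc; _+_; _*_; _^_; _∸_; _<_; _≤_; _≤ᵇ_; _%_; _/_; z≤n; s≤s)
open import Data.Nat.DivMod using (m≡m%n+[m/n]*n; m%n<n; /-monoˡ-≤)
open import Data.Nat.Induction using (<-rec)
open import Data.Nat.Properties
  using (≤-trans; <⇒≤; <-≤-trans; ≤-antisym; ≤-total; n<1+n; m≤n+m; +-comm; *-comm; +-monoʳ-≤; *-suc; +-identityʳ;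
         m<n⇒m<1+n; m∸n+n≡m; +-∸-assoc; m+[n∸m]≡n; m∸n≤m; ∸-monoʳ-≤; m≤n⇒∃[o]m+o≡n; ≤ᵇ⇒≤; ≤⇒≤ᵇ; ≰⇒>; _≤?_)
open import Data.Product using (_×_; _,_; ∃; ∃₂; Σ; proj₁; proj₂; uncurry)
open import Data.Sum using (_⊎_; inj₁; inj₂; [_,_]; swap)
import Data.Sum as Sum
open import Data.Vec using (Vec; []; _∷_; tabulate) renaming (lookup to _!_)
open import Data.Vec.Properties using (lookup∘tabulate; tabulate∘lookup; tabulate-cong; ≡-dec; ∷-injective)
open import Data.Vec.Functional using (Vector; updateAt)
open import Data.Vec.Functional.Properties using (updateAt-updates; updateAt-minimal)
import Data.Vec.Relation.Unary.All as VAll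
open import Data.Vec.Relation.Unary.All.Properties using (tabulate⁺)
import Data.Vec.Relation.Unary.Unique.Propositional as VUnique
import Data.Vec.Relation.Unary.Unique.Propositional.Properties as VUniqueProps
open import Data.Vec.Relation.Unary.AllPairs using ([]; _∷_)
open import Function using (_∘_; id; const)
open import Function.Bundles using (Equivalence)
open import Function.Definitions using (Injective)
open import Relation.Binary.PropositionalEquality hiding ([_])
open import Relation.Nullary using (¬_; ¬?; yes; no; Dec)
open import Relation.Nullary.Decidable using (toWitnessFalse; T?; from-yes; map′)
open import Relation.Unary using (Pred; Decidable; U)

open import Data.List.Membership.DecPropositional (≡-dec {A = Fin 6} {n = 6} _≟_) using (_∈?_)

private
  variable
    A : Set
    m n k : ℕ

-- Iterates and orbits

iter-suc : (f : A → A) (k : ℕ) (x : A) → iter f (suc k) x ≡ iter f k (f x)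
iter-suc f zero    x = refl
iter-suc f (suc k) x = cong f (iter-suc f k x)

iter-+ : (f : A → A) (k l : ℕ) (x : A) → iter f (k + l) x ≡ iter f k (iter f l x)
iter-+ f zero    l x = refl
iter-+ f (suc k) l x = cong f (iter-+ f k l x)

iter-injective : {f : A → A} → Injective _≡_ _≡_ f → ∀ k → Injective _≡_ _≡_ (iter f k)
iter-injective f-inj zero    eq = eq
iter-injective f-inj (suc k) eq = iter-injective f-inj k (f-inj eq)

iter-*-fixed : (f : A → A) {p : ℕ} {x : A} → iter f p x ≡ x → ∀ k → iter f (k * p) x ≡ x
iter-*-fixed f         fix zero    = refl
iter-*-fixed f {p} {x} fix (suc k) =
  trans (iter-+ f p (k * p) x) (trans (cong (iter f p) (iter-*-fixed f fix k)) fix)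

Reach : (A → A) → A → A → Set
Reach f x y = ∃ λ k → iter f k x ≡ y

reach-trans : (f : A → A) {x y z : A} → Reach f x y → Reach f y z → Reach f x z
reach-trans f {x} (k , refl) (l , refl) = l + k , iter-+ f l k x

OneOrbit : (A → A) → Set
OneOrbit {A} f = (x y : A) → Reach f x y

OrbitsCover₂ : (A → A) → Pred A _ → Set
OrbitsCover₂ {A} f P = ∃₂ λ r₁ r₂ → (x : A) → P x → Reach f x r₁ ⊎ Reach f x r₂

module FiniteOrbits {f : A → A} (f-injective : Injective _≡_ _≡_ f)
                    (code : A → Fin m) (code-injective : Injective _≡_ _≡_ code) where

  returns : ∀ x → ∃ λ p → p < m × iter f (suc p) x ≡ x
  returns x with i , j , i<j , eq ← pigeonhole (n<1+n m) (λ i → code (iter f (toℕ i) x)) =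
    toℕ j ∸ suc (toℕ i) , p<m , subst (λ q → iter f q x ≡ x) (+-∸-assoc 1 i<j) back
    where
    p<m : toℕ j ∸ suc (toℕ i) < m
    p<m = subst (_≤ m) (+-∸-assoc 1 i<j) (≤-trans (m∸n≤m (toℕ j) (toℕ i)) (toℕ≤pred[n] j))
    back : iter f (toℕ j ∸ toℕ i) x ≡ x
    back = iter-injective f-injective (toℕ i) (begin
      iter f (toℕ i) (iter f (toℕ j ∸ toℕ i) x)  ≡⟨ iter-+ f (toℕ i) (toℕ j ∸ toℕ i) x ⟨
      iter f (toℕ i + (toℕ j ∸ toℕ i)) x        ≡⟨ cong (λ q → iter f q x) (m+[n∸m]≡n (<⇒≤ i<j)) ⟩
      iter f (toℕ j) x                          ≡⟨ code-injective eq ⟨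
      iter f (toℕ i) x                          ∎)
      where open ≡-Reasoning

  reach-within : ∀ {x y} → Reach f x y → ∃ λ j → j < m × iter f j x ≡ y
  reach-within {x} (k , refl) with p , p<m , back ← returns x =
    k % suc p , <-≤-trans (m%n<n k (suc p)) p<m , (begin
      iter f (k % suc p) x                               ≡⟨ cong (iter f (k % suc p)) (iter-*-fixed f back (k / suc p)) ⟨
      iter f (k % suc p) (iter f (k / suc p * suc p) x)  ≡⟨ iter-+ f (k % suc p) _ x ⟨
      iter f (k % suc p + k / suc p * suc p) x           ≡⟨ cong (λ q → iter f q x) (m≡m%n+[m/n]*n k (suc p)) ⟨
      iter f k x                                         ∎)
    where open ≡-Reasoning

  reach-sym : ∀ {x y} → Reach f x y → Reach f y x
  reach-sym {x} (k , refl) with p , _ , back ← returns x =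
    k * p , (begin
      iter f (k * p) (iter f k x)  ≡⟨ iter-+ f (k * p) k x ⟨
      iter f (k * p + k) x         ≡⟨ cong (λ q → iter f q x) (trans (+-comm (k * p) k) (sym (*-suc k p))) ⟩
      iter f (k * suc p) x         ≡⟨ iter-*-fixed f back k ⟩
      x                            ∎)
    where open ≡-Reasoning

lookup-injective : {xs : List A} → Unique xs → Injective _≡_ _≡_ (lookup xs)
lookup-injective (x∉ ∷ u) {zero}  {zero}  _  = refl
lookup-injective (x∉ ∷ u) {zero}  {suc j} eq = ⊥-elim (All.lookup x∉ (∈-lookup j) eq)
lookup-injective (x∉ ∷ u) {suc i} {zero}  eq = ⊥-elim (All.lookup x∉ (∈-lookup i) (sym eq))
lookup-injective (x∉ ∷ u) {suc i} {suc j} eq = cong suc (lookup-injective u eq)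

unique-length-≤ : {xs : List A} → Unique xs → (g : ∀ {x} → x ∈ xs → Fin k) →
                  (∀ {x y} (p : x ∈ xs) (q : y ∈ xs) → g p ≡ g q → x ≡ y) → length xs ≤ k
unique-length-≤ u g g-injective =
  injective⇒≤ λ {i} {j} eq → lookup-injective u (g-injective (∈-lookup i) (∈-lookup j) eq)

∈⇒length-pos : {x : A} {xs : List A} → x ∈ xs → 1 ≤ length xs
∈⇒length-pos (here _)  = s≤s z≤n
∈⇒length-pos (there _) = s≤s z≤n

lookupOr : A → List A → ℕ → A
lookupOr d []       j       = d
lookupOr d (x ∷ xs) zero    = x
lookupOr d (x ∷ xs) (suc j) = lookupOr d xs j

lookupOr-lookup : (d : A) (xs : List A) {j : ℕ} (j< : j < length xs) → lookupOr d xs j ≡ lookup xs (fromℕ< j<)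
lookupOr-lookup d (x ∷ xs) {zero}  _        = refl
lookupOr-lookup d (x ∷ xs) {suc j} (s≤s j<) = lookupOr-lookup d xs j<

lookupOr-∈ : (d : A) (xs : List A) {j : ℕ} → j < length xs → lookupOr d xs j ∈ xs
lookupOr-∈ d xs j< = subst (_∈ xs) (sym (lookupOr-lookup d xs j<)) (∈-lookup _)

lookupOr-injective : (d : A) {xs : List A} → Unique xs → ∀ {i j} → i < length xs → j < length xs →
                     lookupOr d xs i ≡ lookupOr d xs j → i ≡ j
lookupOr-injective d {xs} u i< j< eq = begin
  _                       ≡⟨ toℕ-fromℕ< i< ⟨
  toℕ (fromℕ< i<)         ≡⟨ cong toℕ (lookup-injective u lookups≡) ⟩
  toℕ (fromℕ< j<)         ≡⟨ toℕ-fromℕ< j< ⟩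
  _                       ∎
  where
  open ≡-Reasoning
  lookups≡ : lookup xs (fromℕ< i<) ≡ lookup xs (fromℕ< j<)
  lookups≡ = trans (sym (lookupOr-lookup d xs i<)) (trans eq (lookupOr-lookup d xs j<))

allᵇ≡all : (p : A → Bool) (xs : List A) → allᵇ p xs ≡ all p xs
allᵇ≡all p []       = refl
allᵇ≡all p (x ∷ xs) = cong (p x ∧_) (allᵇ≡all p xs)

allᵇ⁺ : (p : A → Bool) (xs : List A) → T (allᵇ p xs) → All (T ∘ p) xs
allᵇ⁺ p xs t = all⁺ p xs (subst T (allᵇ≡all p xs) t)

allᵇ⁻ : (p : A → Bool) (xs : List A) → All (T ∘ p) xs → T (allᵇ p xs)
allᵇ⁻ p xs ps = subst T (sym (allᵇ≡all p xs)) (all⁻ p ps)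

updateAt-const-pointwise : {P : A → Set} (xs : Vector A n) (i : Fin n) {x : A} →
                           (∀ j → P (xs j)) → P x → ∀ j → P (updateAt xs i (const x) j)
updateAt-const-pointwise {P = P} xs i all-P Px j with j ≟ i
... | yes refl = subst P (sym (updateAt-updates i xs)) Px
... | no  j≢i  = subst P (sym (updateAt-minimal j i xs j≢i)) (all-P j)

-- Faces and genus

IsDart : Dart n → Set
IsDart (u , v) = u ≢ v

isDart⇒IsDart : (d : Dart n) → T (isDart d) → IsDart d
isDart⇒IsDart (u , v) = toWitnessFalse

iter-faceStep-IsDart : {ρ : RotSys n} → (∀ u v → v ≢ u → ρ u v ≢ u) →
                       ∀ k {d} → IsDart d → IsDart (iter (faceStep ρ) k d)
iter-faceStep-IsDart neighbours zero    dd = dd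
iter-faceStep-IsDart neighbours (suc k) dd with iter-faceStep-IsDart neighbours k dd
... | u≢v = neighbours _ _ u≢v ∘ sym

code : Dart n → Fin (n * n)
code = uncurry combine

code-injective : Injective _≡_ _≡_ (code {n})
code-injective {n} {u , v} {u′ , v′} eq =
  trans (sym (remQuot-combine u v)) (trans (cong (remQuot n) eq) (remQuot-combine u′ v′))

key≡toℕ-code : (d : Dart n) → key d ≡ toℕ (code d)
key≡toℕ-code {n} (u , v) = trans (cong (_+ toℕ v) (*-comm (toℕ u) n)) (sym (toℕ-combine u v))

key-injective : {d e : Dart n} → key d ≡ key e → d ≡ e
key-injective {d = d} {e} eq = code-injective (toℕ-injective (trans (sym (key≡toℕ-code d)) (trans eq (key≡toℕ-code e))))

allPairs≡cartesianProduct : (n : ℕ) → allPairs n ≡ cartesianProduct (allFin n) (allFin n)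
allPairs≡cartesianProduct n = go (allFin n)
  where
  go : (us : List (Fin n)) → concatMap (λ u → map (u ,_) (allFin n)) us ≡ cartesianProduct us (allFin n)
  go []       = refl
  go (u ∷ us) = cong (map (u ,_) (allFin n) ++_) (go us)

allPairs-unique : (n : ℕ) → Unique (allPairs n)
allPairs-unique n = subst Unique (sym (allPairs≡cartesianProduct n)) (cartesianProduct⁺ (allFin⁺ n) (allFin⁺ n))

∈-allPairs : (d : Dart n) → d ∈ allPairs n
∈-allPairs {n} (u , v) = subst (_ ∈_) (sym (allPairs≡cartesianProduct n)) (∈-cartesianProduct⁺ (∈-allFin u) (∈-allFin v))

module _ {ρ : RotSys n} (faceStep-injective : Injective _≡_ _≡_ (faceStep ρ)) where
  open FiniteOrbits faceStep-injective code code-injective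

  leader-minimal : ∀ {d e} → T (isLeader ρ d) → Reach (faceStep ρ) d e → key d ≤ key e
  leader-minimal {d} ℓ r with j , j< , refl ← reach-within r =
    ≤ᵇ⇒≤ _ _ (All.lookup (allᵇ⁺ minimalAt (upTo (n * n)) ℓ) (∈-upTo⁺ j<))
    where
    minimalAt : ℕ → Bool
    minimalAt k = key d ≤ᵇ key (iter (faceStep ρ) k d)

  leaders-unique : ∀ {d e} → T (isLeader ρ d) → T (isLeader ρ e) → Reach (faceStep ρ) d e → d ≡ e
  leaders-unique ℓd ℓe r = key-injective (≤-antisym (leader-minimal ℓd r) (leader-minimal ℓe (reach-sym r)))

  faces-≤-2 : OrbitsCover₂ (faceStep ρ) IsDart → faces n ρ ≤ 2
  faces-≤-2 (r₁ , r₂ , cover) =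
    unique-length-≤ (filter⁺ _ (allPairs-unique n)) (root ∘ cover′) same-root
    where
    isFace : Dart n → Bool
    isFace d = isDart d ∧ isLeader ρ d
    Faces : List (Dart n)
    Faces = filterᵇ isFace (allPairs n)
    face-leader : ∀ {d} → d ∈ Faces → IsDart d × T (isLeader ρ d)
    face-leader {d} p =
      let a , b = Equivalence.to (T-∧ {isDart d}) (proj₂ (∈-filter⁻ (T? ∘ isFace) {xs = allPairs n} p)) in isDart⇒IsDart d a , b
    cover′ : ∀ {d} → d ∈ Faces → Reach (faceStep ρ) d r₁ ⊎ Reach (faceStep ρ) d r₂
    cover′ {d} p = cover d (proj₁ (face-leader p))
    root : ∀ {d} → Reach (faceStep ρ) d r₁ ⊎ Reach (faceStep ρ) d r₂ → Fin 2
    root = [ const zero , const (suc zero) ]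
    same-face : ∀ {d e r} → d ∈ Faces → e ∈ Faces → Reach (faceStep ρ) d r → Reach (faceStep ρ) e r → d ≡ e
    same-face p q rd re = leaders-unique (proj₂ (face-leader p)) (proj₂ (face-leader q))
                                         (reach-trans (faceStep ρ) rd (reach-sym re))
    same-root : ∀ {d e} (p : d ∈ Faces) (q : e ∈ Faces) → root (cover′ p) ≡ root (cover′ q) → d ≡ e
    same-root p q eq with cover′ p | cover′ q
    ... | inj₁ rd | inj₁ re = same-face p q rd re
    ... | inj₂ rd | inj₂ re = same-face p q rd re

key-pos : {d : Dart (2 + n)} → IsDart d → 1 ≤ key d
key-pos {d = zero  , zero}  d≢ = ⊥-elim (d≢ refl)
key-pos {d = zero  , suc v} _  = s≤s z≤n
key-pos {d = suc u , v}     _  = s≤s z≤n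

faces-pos : {ρ : RotSys (2 + n)} → IsRotationSystem (2 + n) ρ → 1 ≤ faces (2 + n) ρ
faces-pos {n} {ρ} R = ∈⇒length-pos (∈-filter⁺ (T? ∘ isFace) (∈-allPairs d₀) (Equivalence.from T-∧ (_ , d₀-leader)))
  where
  isFace : Dart (2 + n) → Bool
  isFace d = isDart d ∧ isLeader ρ d
  d₀ : Dart (2 + n)
  d₀ = zero , suc zero
  minimalAt : ℕ → Bool
  minimalAt k = key d₀ ≤ᵇ key (iter (faceStep ρ) k d₀)
  d₀-leader : T (isLeader ρ d₀)
  d₀-leader = allᵇ⁻ minimalAt (upTo ((2 + n) * (2 + n))) (All.tabulate λ {k} _ →
      ≤⇒≤ᵇ (key-pos (iter-faceStep-IsDart (IsRotationSystem.neighbours R) k {d₀} λ ())))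

genus-K₇-≤ : {ρ : RotSys 7} → 1 ≤ faces 7 ρ → genus 7 ρ ≤ 7
genus-K₇-≤ {ρ} F≥1 = bound (faces 7 ρ) F≥1
  where
  bound : ∀ F → 1 ≤ F → (2 + edgesK 7 ∸ (7 + F)) / 2 ≤ 7
  bound (suc F) _ = /-monoˡ-≤ 2 (m∸n≤m 15 F)

genus-K₇-≥ : {ρ : RotSys 7} → faces 7 ρ ≤ 2 → 7 ≤ genus 7 ρ
genus-K₇-≥ F≤2 = /-monoˡ-≤ 2 (∸-monoʳ-≤ (2 + edgesK 7) (+-monoʳ-≤ 7 F≤2))

-- Euler's formula gives genus (16 ∸ F) / 2 for F faces, so one or two faces is the best possible.
isMaxGenus-K₇ : {ρ : RotSys 7} → IsRotationSystem 7 ρ → faces 7 ρ ≤ 2 → IsMaxGenusEmbedding 7 ρ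
isMaxGenus-K₇ {ρ} R F≤2 = R , λ ρ′ R′ → ≤-trans (genus-K₇-≤ {ρ′} (faces-pos {5} R′)) (genus-K₇-≥ {ρ} F≤2)

-- Rotation systems of K_{n+1} given by tables

-- The local rotation at v is described by a table t on Fin n, transported along punchIn v.
Table : ℕ → Set
Table n = Vec (Fin n) n

State : ℕ → Set
State n = Vector (Table n) (suc n)

IsCyclicTable : Table n → Set
IsCyclicTable t = Injective _≡_ _≡_ (t !_) × OneOrbit (t !_)

rotation : Fin (suc n) → Table n → Fin (suc n) → Fin (suc n)
rotation v t u with u ≟ v
... | yes _   = v
... | no u≢v = punchIn v (t ! punchOut (u≢v ∘ sym))

fromTables : State n → RotSys (suc n)
fromTables s u = rotation u (s u)

rotation-centre : (v : Fin (suc n)) (t : Table n) → rotation v t v ≡ v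
rotation-centre v t with v ≟ v
... | yes _   = refl
... | no v≢v = ⊥-elim (v≢v refl)

rotation-punchIn : (v : Fin (suc n)) (t : Table n) (x : Fin n) → rotation v t (punchIn v x) ≡ punchIn v (t ! x)
rotation-punchIn v t x with punchIn v x ≟ v
... | yes eq = ⊥-elim (punchInᵢ≢i v x eq)
... | no _   = cong (λ y → punchIn v (t ! y)) (trans (punchOut-cong v refl) (punchOut-punchIn v))

rotation-neighbour : (v : Fin (suc n)) (t : Table n) {u : Fin (suc n)} → u ≢ v → rotation v t u ≢ v
rotation-neighbour v t {u} u≢v with u ≟ v
... | yes u≡v = ⊥-elim (u≢v u≡v)
... | no _    = punchInᵢ≢i v _

rotation-injective : (v : Fin (suc n)) {t : Table n} → Injective _≡_ _≡_ (t !_) →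
                     Injective _≡_ _≡_ (rotation v t)
rotation-injective v t-inj {a} {b} eq with a ≟ v | b ≟ v
... | yes a≡v | yes b≡v = trans a≡v (sym b≡v)
... | yes _   | no _    = ⊥-elim (punchInᵢ≢i v _ (sym eq))
... | no _    | yes _   = ⊥-elim (punchInᵢ≢i v _ eq)
... | no a≢v  | no b≢v  = punchOut-injective (a≢v ∘ sym) (b≢v ∘ sym) (t-inj (punchIn-injective v _ _ eq))

iter-rotation-punchIn : (v : Fin (suc n)) (t : Table n) (k : ℕ) (x : Fin n) →
                        iter (rotation v t) k (punchIn v x) ≡ punchIn v (iter (t !_) k x)
iter-rotation-punchIn v t zero    x = refl
iter-rotation-punchIn v t (suc k) x =
  trans (cong (rotation v t) (iter-rotation-punchIn v t k x)) (rotation-punchIn v t (iter (t !_) k x))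

fromTables-isRotationSystem : {s : State n} → (∀ u → IsCyclicTable (s u)) → IsRotationSystem (suc n) (fromTables s)
fromTables-isRotationSystem {n} {s} cyclic = record
  { fixes-centre = λ u → rotation-centre u (s u)
  ; neighbours   = λ u v → rotation-neighbour u (s u)
  ; one-cycle    = one-cycle
  }
  where
  one-cycle : ∀ u v w → v ≢ u → w ≢ u → ∃ λ k → k < n × iter (fromTables s u) k v ≡ w
  one-cycle u v w v≢u w≢u with k , k<n , eq ← FiniteOrbits.reach-within (proj₁ (cyclic u)) id id
                                            (proj₂ (cyclic u) (punchOut (v≢u ∘ sym)) (punchOut (w≢u ∘ sym))) =
    k , k<n , (begin
      iter (rotation u (s u)) k v                                ≡⟨ cong (iter (rotation u (s u)) k) (punchIn-punchOut (v≢u ∘ sym)) ⟨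
      iter (rotation u (s u)) k (punchIn u (punchOut (v≢u ∘ sym))) ≡⟨ iter-rotation-punchIn u (s u) k _ ⟩
      punchIn u (iter (s u !_) k (punchOut (v≢u ∘ sym)))            ≡⟨ cong (punchIn u) eq ⟩
      punchIn u (punchOut (w≢u ∘ sym))                             ≡⟨ punchIn-punchOut (w≢u ∘ sym) ⟩
      w                                                            ∎)
    where
    open ≡-Reasoning

fromTables-injective : {s s′ : State n} → SameRot (fromTables s) (fromTables s′) → ∀ u → s u ≡ s′ u
fromTables-injective {s = s} {s′} same u = begin
  s u                       ≡⟨ tabulate∘lookup (s u) ⟨
  tabulate (s u !_)         ≡⟨ tabulate-cong entries ⟩
  tabulate (s′ u !_)        ≡⟨ tabulate∘lookup (s′ u) ⟩
  s′ u                      ∎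
  where
  open ≡-Reasoning
  entries : ∀ x → s u ! x ≡ s′ u ! x
  entries x = punchIn-injective u _ _
    (trans (sym (rotation-punchIn u (s u) x)) (trans (same u (punchIn u x)) (rotation-punchIn u (s′ u) x)))

faceStep-fromTables-injective : {s : State n} → (∀ u → Injective _≡_ _≡_ (s u !_)) →
                                Injective _≡_ _≡_ (faceStep (fromTables s))
faceStep-fromTables-injective {s = s} inj {a₁ , a₂} {b₁ , b₂} eq with cong proj₁ eq
... | refl = cong (_, a₂) (rotation-injective a₂ (inj a₂) (cong proj₂ eq))

-- Re-choosing the rotation at one vertex

punchOutOr : Fin n → Fin (suc n) → Fin (suc n) → Fin n
punchOutOr x v u with v ≟ u
... | yes _   = x
... | no v≢u = punchOut v≢u

punchOutOr-punchIn : (x : Fin n) (v : Fin (suc n)) (y : Fin n) → punchOutOr x v (punchIn v y) ≡ y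
punchOutOr-punchIn x v y with v ≟ punchIn v y
... | yes v≡ = ⊥-elim (punchInᵢ≢i v y (sym v≡))
... | no _   = trans (punchOut-cong v refl) (punchOut-punchIn v)

module _ {P : A → Set} (P? : Decidable P) (f : A → A) where

  firstHit : ℕ → A → ℕ
  firstHit zero       x = 0
  firstHit (suc fuel) x with P? x
  ... | yes _ = 0
  ... | no  _ = suc (firstHit fuel (f x))

  IsFirstHit : A → ℕ → Set
  IsFirstHit x m = P (iter f m x) × (∀ j → j < m → ¬ P (iter f j x))

  firstHit-isFirstHit : ∀ fuel x k → k < fuel → P (iter f k x) → IsFirstHit x (firstHit fuel x)
  firstHit-isFirstHit (suc fuel) x k k< hit with P? x
  ... | yes px = px , λ _ ()
  firstHit-isFirstHit (suc fuel) x zero    k<        hit | no ¬px = ⊥-elim (¬px hit)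
  firstHit-isFirstHit (suc fuel) x (suc k) (s≤s k<) hit | no ¬px
    with hit′ , before ← firstHit-isFirstHit fuel (f x) k k< (subst P (iter-suc f k x) hit) =
      subst P (sym (iter-suc f (firstHit fuel (f x)) x)) hit′ , λ where
        zero    _        → ¬px
        (suc j) (s≤s j<) → before j j< ∘ subst P (iter-suc f j x)

  isFirstHit-minimal : ∀ {x m k} → IsFirstHit x m → P (iter f k x) → m ≤ k
  isFirstHit-minimal {m = m} {k} (_ , before) hit with m ≤? k
  ... | yes m≤k = m≤k
  ... | no  m≰k = ⊥-elim (before k (≰⇒> m≰k) hit)

into : Fin (suc n) → Fin n → Dart (suc n)
into v x = punchIn v x , v

out : Fin (suc n) → Fin n → Dart (suc n)
out v w = v , punchIn v w

EndsAt : Fin (suc n) → Dart (suc n) → Set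
EndsAt v d = proj₂ d ≡ v

endsAt? : (v : Fin (suc n)) → Decidable (EndsAt v)
endsAt? v d = proj₂ d ≟ v

exitTime : State n → Fin (suc n) → Dart (suc n) → ℕ
exitTime {n} s v = firstHit (endsAt? v) (faceStep (fromTables s)) (suc n * suc n)

-- The face of s through out v w next enters v along into v (returnTable s v ! w).
-- (The junk value w of punchOutOr is never used.)
returnTable : State n → Fin (suc n) → Table n
returnTable s v = tabulate λ w →
  punchOutOr w v (proj₁ (iter (faceStep (fromTables s)) (exitTime s v (out v w)) (out v w)))

module Surgery {s : State n} (s-injective : ∀ u → Injective _≡_ _≡_ (s u !_)) (v : Fin (suc n)) where

  private
    f : Dart (suc n) → Dart (suc n)
    f = faceStep (fromTables s)

    f-injective : Injective _≡_ _≡_ f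
    f-injective = faceStep-fromTables-injective s-injective

    ret : Fin n → Fin n
    ret = returnTable s v !_

  open FiniteOrbits f-injective code code-injective

  Visits : Dart (suc n) → Set
  Visits d = ∃ λ k → EndsAt v (iter f k d)

  iter-IsDart : ∀ k {d} → IsDart d → IsDart (iter f k d)
  iter-IsDart = iter-faceStep-IsDart (λ u _ → rotation-neighbour u (s u))

  into-of : ∀ {d} → IsDart d → EndsAt v d → ∃ λ x → d ≡ into v x
  into-of {u , _} u≢v refl = punchOut (u≢v ∘ sym) , cong (_, v) (sym (punchIn-punchOut (u≢v ∘ sym)))

  exitTime-isFirstHit : ∀ {d} → Visits d → IsFirstHit (endsAt? v) f d (exitTime s v d)
  exitTime-isFirstHit {d} (k , hit) =
    let j , j< , eq = reach-within {d} (k , refl)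
    in firstHit-isFirstHit (endsAt? v) f (suc n * suc n) d j j< (subst (EndsAt v) (sym eq) hit)

  visits? : ∀ d → Dec (Visits d)
  visits? d = map′ (exitTime s v d ,_) (proj₁ ∘ exitTime-isFirstHit) (endsAt? v (iter f (exitTime s v d) d))

  visits-backward : ∀ {d e} → Reach f d e → Visits e → Visits d
  visits-backward {d} (k , refl) (j , hit) = j + k , subst (EndsAt v) (sym (iter-+ f j k d)) hit

  avoiding : ∀ {d r} → ¬ Visits r → Reach f d r → ¬ Visits d
  avoiding ¬vr r vd = ¬vr (visits-backward (reach-sym r) vd)

  out-visits : ∀ w → Visits (out v w)
  out-visits w = let p , _ , back = returns (out v w) in p , cong proj₁ back

  exit-out : ∀ w → iter f (exitTime s v (out v w)) (out v w) ≡ into v (ret w)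
  exit-out w =
    let x , e≡ = into-of (iter-IsDart (exitTime s v (out v w)) (punchInᵢ≢i v w ∘ sym)) (proj₁ (exitTime-isFirstHit (out-visits w)))
    in trans e≡ (cong (into v) (sym (ret≡ x e≡)))
    where
    ret≡ : ∀ x → iter f (exitTime s v (out v w)) (out v w) ≡ into v x → ret w ≡ x
    ret≡ x e≡ = trans (lookup∘tabulate _ w) (trans (cong (punchOutOr w v ∘ proj₁) e≡) (punchOutOr-punchIn w v x))

  exit-injective-≤ : ∀ {a b ma mb} → proj₁ a ≡ v → IsFirstHit (endsAt? v) f b mb → ma ≤ mb →
                     iter f ma a ≡ iter f mb b → a ≡ b
  exit-injective-≤ {a} {b} {ma} a-out (_ , before) ma≤mb eq with m≤n⇒∃[o]m+o≡n ma≤mb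
  ... | zero  , refl = iter-injective f-injective ma (trans eq (cong (λ q → iter f q b) (+-identityʳ ma)))
  ... | suc t , refl = ⊥-elim (before t (m≤n+m (suc t) ma) (trans (cong proj₁ (sym a≡)) a-out))
    where
    a≡ : a ≡ f (iter f t b)
    a≡ = iter-injective f-injective ma (trans eq (iter-+ f ma (suc t) b))

  returnTable-injective : Injective _≡_ _≡_ ret
  returnTable-injective {w} {w′} eq = punchIn-injective v _ _ (cong proj₂ (exits-equal (≤-total t t′)))
    where
    t t′ : ℕ
    t = exitTime s v (out v w)
    t′ = exitTime s v (out v w′)
    same-exit : iter f t (out v w) ≡ iter f t′ (out v w′)
    same-exit = trans (exit-out w) (trans (cong (into v) eq) (sym (exit-out w′)))
    exits-equal : t ≤ t′ ⊎ t′ ≤ t → out v w ≡ out v w′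
    exits-equal (inj₁ t≤t′) = exit-injective-≤ refl (exitTime-isFirstHit (out-visits w′)) t≤t′ same-exit
    exits-equal (inj₂ t′≤t) = sym (exit-injective-≤ refl (exitTime-isFirstHit (out-visits w)) t′≤t (sym same-exit))

  σ₀ : Fin n → Fin n
  σ₀ = ret ∘ (s v !_)

  into-step : ∀ x → f (into v x) ≡ out v (s v ! x)
  into-step x = cong (v ,_) (rotation-punchIn v (s v) x)

  -- Between two visits to v the face of s follows one step of σ₀.
  reach-into⇒reach-σ₀ : ∀ {x y} → Reach f (into v x) (into v y) → Reach σ₀ x y
  reach-into⇒reach-σ₀ (k , eq) = <-rec _ go k eq
    where
    go : ∀ k → (∀ {j} → j < k → ∀ {x y} → iter f j (into v x) ≡ into v y → Reach σ₀ x y) →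
         ∀ {x y} → iter f k (into v x) ≡ into v y → Reach σ₀ x y
    go zero    _   eq = 0 , punchIn-injective v _ _ (cong proj₁ eq)
    go (suc k) rec {x} {y} eq = reach-trans σ₀ (1 , refl) (rec (s≤s (m∸n≤m k t)) rest)
      where
      w = s v ! x
      t = exitTime s v (out v w)
      from-out : iter f k (out v w) ≡ into v y
      from-out = trans (cong (iter f k) (sym (into-step x))) (trans (sym (iter-suc f k (into v x))) eq)
      t≤k : t ≤ k
      t≤k = isFirstHit-minimal (endsAt? v) f (exitTime-isFirstHit (out-visits w)) (cong proj₂ from-out)
      rest : iter f (k ∸ t) (into v (ret w)) ≡ into v y
      rest = begin
        iter f (k ∸ t) (into v (ret w))        ≡⟨ cong (iter f (k ∸ t)) (exit-out w) ⟨
        iter f (k ∸ t) (iter f t (out v w))    ≡⟨ iter-+ f (k ∸ t) t (out v w) ⟨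
        iter f (k ∸ t + t) (out v w)           ≡⟨ cong (λ q → iter f q (out v w)) (m∸n+n≡m t≤k) ⟩
        iter f k (out v w)                     ≡⟨ from-out ⟩
        into v y                               ∎
        where open ≡-Reasoning

  σ₀-oneOrbit : ∀ {r₁ r₂} → (∀ d → IsDart d → Reach f d r₁ ⊎ Reach f d r₂) → ¬ Visits r₁ → OneOrbit σ₀
  σ₀-oneOrbit {r₁} {r₂} cover ¬v₁ x y = reach-into⇒reach-σ₀ (reach-trans f (to-r₂ x) (reach-sym (to-r₂ y)))
    where
    to-r₂ : ∀ x → Reach f (into v x) r₂
    to-r₂ x = [ (λ r → ⊥-elim (avoiding ¬v₁ r (0 , refl))) , id ] (cover (into v x) (punchInᵢ≢i v x))

  module _ (c : Table n) where

    private
      f′ : Dart (suc n) → Dart (suc n)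
      f′ = faceStep (fromTables (updateAt s v (const c)))

    σ : Fin n → Fin n
    σ = ret ∘ (c !_)

    step-agrees : ∀ {d} → ¬ EndsAt v d → f′ d ≡ f d
    step-agrees {a , b} b≢v = cong (λ t → b , rotation b t a) (updateAt-minimal b v s b≢v)

    iter-agrees : ∀ k {d} → (∀ j → j < k → ¬ EndsAt v (iter f j d)) → iter f′ k d ≡ iter f k d
    iter-agrees zero    avoid = refl
    iter-agrees (suc k) avoid =
      trans (cong f′ (iter-agrees k (λ j j< → avoid j (m<n⇒m<1+n j<)))) (step-agrees {iter f k _} (avoid k (n<1+n k)))

    into-step′ : ∀ x → f′ (into v x) ≡ out v (c ! x)
    into-step′ x =
      cong (v ,_) (trans (cong (λ t → rotation v t (punchIn v x)) (updateAt-updates v s)) (rotation-punchIn v c x))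

    exit-agrees : ∀ {d} → Visits d → iter f′ (exitTime s v d) d ≡ iter f (exitTime s v d) d
    exit-agrees vd = iter-agrees _ (proj₂ (exitTime-isFirstHit vd))

    reach-σ⇒reach-into : ∀ {x y} → Reach σ x y → Reach f′ (into v x) (into v y)
    reach-σ⇒reach-into (zero  , refl) = 0 , refl
    reach-σ⇒reach-into {x} (suc k , refl) = reach-trans f′ (reach-σ⇒reach-into (k , refl)) (σ-step (iter σ k x))
      where
      σ-step : ∀ z → Reach f′ (into v z) (into v (σ z))
      σ-step z = t + 1 , (begin
        iter f′ (t + 1) (into v z)  ≡⟨ iter-+ f′ t 1 (into v z) ⟩
        iter f′ t (f′ (into v z))   ≡⟨ cong (iter f′ t) (into-step′ z) ⟩
        iter f′ t (out v (c ! z))   ≡⟨ exit-agrees (out-visits (c ! z)) ⟩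
        iter f t (out v (c ! z))    ≡⟨ exit-out (c ! z) ⟩
        into v (σ z)                ∎)
        where
        open ≡-Reasoning
        t = exitTime s v (out v (c ! z))

    visits⇒reach-into : ∀ {d} → IsDart d → Visits d → ∃ λ x → Reach f′ d (into v x)
    visits⇒reach-into {d} dd vd =
      let x , eq = into-of (iter-IsDart (exitTime s v d) dd) (proj₁ (exitTime-isFirstHit vd))
      in x , exitTime s v d , trans (exit-agrees vd) eq

    unaffected : ∀ {d r} → ¬ Visits r → Reach f d r → Reach f′ d r
    unaffected ¬vr r@(k , refl) = k , iter-agrees k (λ j _ hit → avoiding ¬vr r (j , hit))

    one-visits : ∀ {r r′} → (∀ d → IsDart d → Reach f d r ⊎ Reach f d r′) → ¬ Visits r → Visits r′ →
                 (OneOrbit σ₀ → OneOrbit σ) → (y : Fin n) → OrbitsCover₂ f′ IsDart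
    one-visits {r} {r′} cover ¬v v′ keep y = r , into v y , λ d dd → Sum.map (unaffected ¬v) (via-σ d dd) (cover d dd)
      where
      via-σ : ∀ d → IsDart d → Reach f d r′ → Reach f′ d (into v y)
      via-σ d dd rd = let x , r = visits⇒reach-into dd (visits-backward rd v′)
                      in reach-trans f′ r (reach-σ⇒reach-into (keep (σ₀-oneOrbit cover ¬v) x y))

    surgery : OrbitsCover₂ f IsDart → OrbitsCover₂ σ U → (OneOrbit σ₀ → OneOrbit σ) → OrbitsCover₂ f′ IsDart
    surgery (r₁ , r₂ , cover) (y₁ , y₂ , σ-cover) keep = by-visits (visits? r₁) (visits? r₂)
      where
      by-visits : Dec (Visits r₁) → Dec (Visits r₂) → OrbitsCover₂ f′ IsDart
      by-visits (no ¬v₁) (no ¬v₂) = r₁ , r₂ , λ d dd → Sum.map (unaffected ¬v₁) (unaffected ¬v₂) (cover d dd)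
      by-visits (no ¬v₁) (yes v₂) = one-visits cover ¬v₁ v₂ keep y₁
      by-visits (yes v₁) (no ¬v₂) = one-visits (λ d dd → swap (cover d dd)) ¬v₂ v₁ keep y₁
      by-visits (yes v₁) (yes v₂) = into v y₁ , into v y₂ , λ d dd →
        let x , r = visits⇒reach-into dd ([ (λ r → visits-backward r v₁) , (λ r → visits-backward r v₂) ] (cover d dd))
        in Sum.map (reach-trans f′ r ∘ reach-σ⇒reach-into) (reach-trans f′ r ∘ reach-σ⇒reach-into) (σ-cover x _)

_==_ : Fin n → Fin n → Bool
zero  == zero  = true
suc x == suc y = x == y
_     == _     = false

==⇒≡ : {x y : Fin n} → T (x == y) → x ≡ y
==⇒≡ {x = zero}  {zero}  _  = refl
==⇒≡ {x = suc x} {suc y} eq = cong suc (==⇒≡ eq)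

≡⇒== : {x y : Fin n} → x ≡ y → T (x == y)
≡⇒== {x = zero}  refl = _
≡⇒== {x = suc x} refl = ≡⇒== {x = x} refl

reachesWithin : ℕ → (A → A) → (A → Bool) → A → Bool
reachesWithin zero    f P x = false
reachesWithin (suc k) f P x = P x ∨ reachesWithin k f P (f x)

reachesWithin-sound : ∀ k {f : A → A} {P : A → Bool} {x} → T (reachesWithin k f P x) → ∃ λ j → T (P (iter f j x))
reachesWithin-sound (suc k) {f} {P} {x} t with Equivalence.to (T-∨ {P x}) t
... | inj₁ px = 0 , px
... | inj₂ rest with j , pj ← reachesWithin-sound k rest = suc j , subst (T ∘ P) (sym (iter-suc f j x)) pj

reachesWithin-complete : ∀ {k j} {f : A → A} {P : A → Bool} {x} → j < k → T (P (iter f j x)) → T (reachesWithin k f P x)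
reachesWithin-complete {j = zero}  {P = P} {x} (s≤s _) px = Equivalence.from (T-∨ {P x}) (inj₁ px)
reachesWithin-complete {j = suc j} {f} {P} {x} (s≤s j<k) pj =
  Equivalence.from (T-∨ {P x}) (inj₂ (reachesWithin-complete j<k (subst (T ∘ P) (iter-suc f j x) pj)))

all-allFin : {p : Fin n → Bool} → T (allᵇ p (allFin n)) → ∀ x → T (p x)
all-allFin {n} {p} t x = All.lookup (allᵇ⁺ p (allFin n) t) (∈-allFin x)

allFin-all : {p : Fin n → Bool} → (∀ x → T (p x)) → T (allᵇ p (allFin n))
allFin-all {n} {p} h = allᵇ⁻ p (allFin n) (All.tabulate λ {x} _ → h x)

injectiveᵇ : (Fin n → Fin n) → Bool
injectiveᵇ {n} f = allᵇ (λ x → allᵇ (λ y → (x == y) ∨ not (f x == f y)) (allFin n)) (allFin n)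

injectiveᵇ-sound : {f : Fin n → Fin n} → T (injectiveᵇ f) → Injective _≡_ _≡_ f
injectiveᵇ-sound {f = f} t {x} {y} eq with Equivalence.to (T-∨ {x == y}) (all-allFin (all-allFin t x) y)
... | inj₁ x==y   = ==⇒≡ x==y
... | inj₂ fx≠fy = ⊥-elim (subst T (Equivalence.to T-not-≡ fx≠fy) (≡⇒== eq))

injectiveᵇ-complete : {f : Fin n → Fin n} → Injective _≡_ _≡_ f → T (injectiveᵇ f)
injectiveᵇ-complete {f = f} inj = allFin-all λ x → allFin-all λ y → entry x y
  where
  entry : ∀ x y → T ((x == y) ∨ not (f x == f y))
  entry x y with f x == f y in fx==fy
  ... | false = Equivalence.from (T-∨ {x == y}) (inj₂ _)
  ... | true  = Equivalence.from (T-∨ {x == y}) (inj₁ (≡⇒== (inj (==⇒≡ (subst T (sym fx==fy) _)))))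

oneOrbitᵇ : (Fin n → Fin n) → Bool
oneOrbitᵇ {n} f = allᵇ (λ x → allᵇ (λ y → reachesWithin n f (_== y) x) (allFin n)) (allFin n)

oneOrbitᵇ-sound : {f : Fin n → Fin n} → T (oneOrbitᵇ f) → OneOrbit f
oneOrbitᵇ-sound {n} t x y with j , hit ← reachesWithin-sound n (all-allFin (all-allFin t x) y) = j , ==⇒≡ hit

oneOrbitᵇ-complete : {f : Fin n → Fin n} → Injective _≡_ _≡_ f → OneOrbit f → T (oneOrbitᵇ f)
oneOrbitᵇ-complete inj one = allFin-all λ x → allFin-all λ y →
  let j , j<n , eq = FiniteOrbits.reach-within inj id id (one x y) in reachesWithin-complete j<n (≡⇒== eq)

reachesZeroOrᵇ : (Fin (suc n) → Fin (suc n)) → Fin (suc n) → Fin (suc n) → Bool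
reachesZeroOrᵇ {n} f y = reachesWithin (suc n) f (λ z → (z == zero) ∨ (z == y))

twoOrbitsᵇ : (Fin (suc n) → Fin (suc n)) → Bool
twoOrbitsᵇ {n} f = any (λ y → allᵇ (reachesZeroOrᵇ f y) (allFin _)) (allFin _)

twoOrbitsᵇ-sound : {f : Fin (suc n) → Fin (suc n)} → T (twoOrbitsᵇ f) → OrbitsCover₂ f U
twoOrbitsᵇ-sound {n} {f} t with y , t′ ← satisfied (any⁻ _ (allFin (suc n)) t) = zero , y , λ x _ → cover x
  where
  cover : ∀ x → Reach f x zero ⊎ Reach f x y
  cover x with j , hit ← reachesWithin-sound (suc n) (all-allFin {p = reachesZeroOrᵇ f y} t′ x) =
    [ (λ h → inj₁ (j , ==⇒≡ h)) , (λ h → inj₂ (j , ==⇒≡ h)) ] (Equivalence.to (T-∨ {iter f j x == zero}) hit)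

allVecᵇ : ∀ {k} n → (Vec (Fin k) n → Bool) → Bool
allVecᵇ zero    p = p []
allVecᵇ (suc n) p = allᵇ (λ a → allVecᵇ n (λ t → p (a ∷ t))) (allFin _)

allVecᵇ-sound : ∀ {k} n {p : Vec (Fin k) n → Bool} → allVecᵇ n p ≡ true → ∀ t → T (p t)
allVecᵇ-sound n {p} eq = go n (Equivalence.from T-≡ eq)
  where
  go : ∀ {k} n {p : Vec (Fin k) n → Bool} → T (allVecᵇ n p) → ∀ t → T (p t)
  go zero    t []      = t
  go (suc n) t (a ∷ v) = go n (all-allFin t a) v

cyclicTables : List (Table 6)
cyclicTables =
  (# 1 ∷ # 2 ∷ # 3 ∷ # 4 ∷ # 5 ∷ # 0 ∷ []) ∷
  (# 1 ∷ # 2 ∷ # 3 ∷ # 5 ∷ # 0 ∷ # 4 ∷ []) ∷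
  (# 1 ∷ # 2 ∷ # 4 ∷ # 0 ∷ # 5 ∷ # 3 ∷ []) ∷
  (# 1 ∷ # 2 ∷ # 4 ∷ # 5 ∷ # 3 ∷ # 0 ∷ []) ∷
  (# 1 ∷ # 2 ∷ # 5 ∷ # 0 ∷ # 3 ∷ # 4 ∷ []) ∷
  (# 1 ∷ # 2 ∷ # 5 ∷ # 4 ∷ # 0 ∷ # 3 ∷ []) ∷
  (# 1 ∷ # 3 ∷ # 0 ∷ # 4 ∷ # 5 ∷ # 2 ∷ []) ∷
  (# 1 ∷ # 3 ∷ # 0 ∷ # 5 ∷ # 2 ∷ # 4 ∷ []) ∷
  (# 1 ∷ # 3 ∷ # 4 ∷ # 2 ∷ # 5 ∷ # 0 ∷ []) ∷
  (# 1 ∷ # 3 ∷ # 4 ∷ # 5 ∷ # 0 ∷ # 2 ∷ []) ∷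
  (# 1 ∷ # 3 ∷ # 5 ∷ # 2 ∷ # 0 ∷ # 4 ∷ []) ∷
  (# 1 ∷ # 3 ∷ # 5 ∷ # 4 ∷ # 2 ∷ # 0 ∷ []) ∷
  (# 1 ∷ # 4 ∷ # 0 ∷ # 2 ∷ # 5 ∷ # 3 ∷ []) ∷
  (# 1 ∷ # 4 ∷ # 0 ∷ # 5 ∷ # 3 ∷ # 2 ∷ []) ∷
  (# 1 ∷ # 4 ∷ # 3 ∷ # 0 ∷ # 5 ∷ # 2 ∷ []) ∷
  (# 1 ∷ # 4 ∷ # 3 ∷ # 5 ∷ # 2 ∷ # 0 ∷ []) ∷
  (# 1 ∷ # 4 ∷ # 5 ∷ # 0 ∷ # 2 ∷ # 3 ∷ []) ∷
  (# 1 ∷ # 4 ∷ # 5 ∷ # 2 ∷ # 3 ∷ # 0 ∷ []) ∷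
  (# 1 ∷ # 5 ∷ # 0 ∷ # 2 ∷ # 3 ∷ # 4 ∷ []) ∷
  (# 1 ∷ # 5 ∷ # 0 ∷ # 4 ∷ # 2 ∷ # 3 ∷ []) ∷
  (# 1 ∷ # 5 ∷ # 3 ∷ # 0 ∷ # 2 ∷ # 4 ∷ []) ∷
  (# 1 ∷ # 5 ∷ # 3 ∷ # 4 ∷ # 0 ∷ # 2 ∷ []) ∷
  (# 1 ∷ # 5 ∷ # 4 ∷ # 0 ∷ # 3 ∷ # 2 ∷ []) ∷
  (# 1 ∷ # 5 ∷ # 4 ∷ # 2 ∷ # 0 ∷ # 3 ∷ []) ∷
  (# 2 ∷ # 0 ∷ # 3 ∷ # 4 ∷ # 5 ∷ # 1 ∷ []) ∷
  (# 2 ∷ # 0 ∷ # 3 ∷ # 5 ∷ # 1 ∷ # 4 ∷ []) ∷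
  (# 2 ∷ # 0 ∷ # 4 ∷ # 1 ∷ # 5 ∷ # 3 ∷ []) ∷
  (# 2 ∷ # 0 ∷ # 4 ∷ # 5 ∷ # 3 ∷ # 1 ∷ []) ∷
  (# 2 ∷ # 0 ∷ # 5 ∷ # 1 ∷ # 3 ∷ # 4 ∷ []) ∷
  (# 2 ∷ # 0 ∷ # 5 ∷ # 4 ∷ # 1 ∷ # 3 ∷ []) ∷
  (# 2 ∷ # 3 ∷ # 1 ∷ # 4 ∷ # 5 ∷ # 0 ∷ []) ∷
  (# 2 ∷ # 3 ∷ # 1 ∷ # 5 ∷ # 0 ∷ # 4 ∷ []) ∷
  (# 2 ∷ # 3 ∷ # 4 ∷ # 0 ∷ # 5 ∷ # 1 ∷ []) ∷
  (# 2 ∷ # 3 ∷ # 4 ∷ # 5 ∷ # 1 ∷ # 0 ∷ []) ∷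
  (# 2 ∷ # 3 ∷ # 5 ∷ # 0 ∷ # 1 ∷ # 4 ∷ []) ∷
  (# 2 ∷ # 3 ∷ # 5 ∷ # 4 ∷ # 0 ∷ # 1 ∷ []) ∷
  (# 2 ∷ # 4 ∷ # 1 ∷ # 0 ∷ # 5 ∷ # 3 ∷ []) ∷
  (# 2 ∷ # 4 ∷ # 1 ∷ # 5 ∷ # 3 ∷ # 0 ∷ []) ∷
  (# 2 ∷ # 4 ∷ # 3 ∷ # 1 ∷ # 5 ∷ # 0 ∷ []) ∷
  (# 2 ∷ # 4 ∷ # 3 ∷ # 5 ∷ # 0 ∷ # 1 ∷ []) ∷
  (# 2 ∷ # 4 ∷ # 5 ∷ # 0 ∷ # 3 ∷ # 1 ∷ []) ∷
  (# 2 ∷ # 4 ∷ # 5 ∷ # 1 ∷ # 0 ∷ # 3 ∷ []) ∷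
  (# 2 ∷ # 5 ∷ # 1 ∷ # 0 ∷ # 3 ∷ # 4 ∷ []) ∷
  (# 2 ∷ # 5 ∷ # 1 ∷ # 4 ∷ # 0 ∷ # 3 ∷ []) ∷
  (# 2 ∷ # 5 ∷ # 3 ∷ # 1 ∷ # 0 ∷ # 4 ∷ []) ∷
  (# 2 ∷ # 5 ∷ # 3 ∷ # 4 ∷ # 1 ∷ # 0 ∷ []) ∷
  (# 2 ∷ # 5 ∷ # 4 ∷ # 0 ∷ # 1 ∷ # 3 ∷ []) ∷
  (# 2 ∷ # 5 ∷ # 4 ∷ # 1 ∷ # 3 ∷ # 0 ∷ []) ∷
  (# 3 ∷ # 0 ∷ # 1 ∷ # 4 ∷ # 5 ∷ # 2 ∷ []) ∷
  (# 3 ∷ # 0 ∷ # 1 ∷ # 5 ∷ # 2 ∷ # 4 ∷ []) ∷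
  (# 3 ∷ # 0 ∷ # 4 ∷ # 2 ∷ # 5 ∷ # 1 ∷ []) ∷
  (# 3 ∷ # 0 ∷ # 4 ∷ # 5 ∷ # 1 ∷ # 2 ∷ []) ∷
  (# 3 ∷ # 0 ∷ # 5 ∷ # 2 ∷ # 1 ∷ # 4 ∷ []) ∷
  (# 3 ∷ # 0 ∷ # 5 ∷ # 4 ∷ # 2 ∷ # 1 ∷ []) ∷
  (# 3 ∷ # 2 ∷ # 0 ∷ # 4 ∷ # 5 ∷ # 1 ∷ []) ∷
  (# 3 ∷ # 2 ∷ # 0 ∷ # 5 ∷ # 1 ∷ # 4 ∷ []) ∷
  (# 3 ∷ # 2 ∷ # 4 ∷ # 1 ∷ # 5 ∷ # 0 ∷ []) ∷
  (# 3 ∷ # 2 ∷ # 4 ∷ # 5 ∷ # 0 ∷ # 1 ∷ []) ∷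
  (# 3 ∷ # 2 ∷ # 5 ∷ # 1 ∷ # 0 ∷ # 4 ∷ []) ∷
  (# 3 ∷ # 2 ∷ # 5 ∷ # 4 ∷ # 1 ∷ # 0 ∷ []) ∷
  (# 3 ∷ # 4 ∷ # 0 ∷ # 1 ∷ # 5 ∷ # 2 ∷ []) ∷
  (# 3 ∷ # 4 ∷ # 0 ∷ # 5 ∷ # 2 ∷ # 1 ∷ []) ∷
  (# 3 ∷ # 4 ∷ # 1 ∷ # 2 ∷ # 5 ∷ # 0 ∷ []) ∷
  (# 3 ∷ # 4 ∷ # 1 ∷ # 5 ∷ # 0 ∷ # 2 ∷ []) ∷
  (# 3 ∷ # 4 ∷ # 5 ∷ # 1 ∷ # 2 ∷ # 0 ∷ []) ∷
  (# 3 ∷ # 4 ∷ # 5 ∷ # 2 ∷ # 0 ∷ # 1 ∷ []) ∷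
  (# 3 ∷ # 5 ∷ # 0 ∷ # 1 ∷ # 2 ∷ # 4 ∷ []) ∷
  (# 3 ∷ # 5 ∷ # 0 ∷ # 4 ∷ # 1 ∷ # 2 ∷ []) ∷
  (# 3 ∷ # 5 ∷ # 1 ∷ # 2 ∷ # 0 ∷ # 4 ∷ []) ∷
  (# 3 ∷ # 5 ∷ # 1 ∷ # 4 ∷ # 2 ∷ # 0 ∷ []) ∷
  (# 3 ∷ # 5 ∷ # 4 ∷ # 1 ∷ # 0 ∷ # 2 ∷ []) ∷
  (# 3 ∷ # 5 ∷ # 4 ∷ # 2 ∷ # 1 ∷ # 0 ∷ []) ∷
  (# 4 ∷ # 0 ∷ # 1 ∷ # 2 ∷ # 5 ∷ # 3 ∷ []) ∷
  (# 4 ∷ # 0 ∷ # 1 ∷ # 5 ∷ # 3 ∷ # 2 ∷ []) ∷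
  (# 4 ∷ # 0 ∷ # 3 ∷ # 1 ∷ # 5 ∷ # 2 ∷ []) ∷
  (# 4 ∷ # 0 ∷ # 3 ∷ # 5 ∷ # 2 ∷ # 1 ∷ []) ∷
  (# 4 ∷ # 0 ∷ # 5 ∷ # 1 ∷ # 2 ∷ # 3 ∷ []) ∷
  (# 4 ∷ # 0 ∷ # 5 ∷ # 2 ∷ # 3 ∷ # 1 ∷ []) ∷
  (# 4 ∷ # 2 ∷ # 0 ∷ # 1 ∷ # 5 ∷ # 3 ∷ []) ∷
  (# 4 ∷ # 2 ∷ # 0 ∷ # 5 ∷ # 3 ∷ # 1 ∷ []) ∷
  (# 4 ∷ # 2 ∷ # 3 ∷ # 0 ∷ # 5 ∷ # 1 ∷ []) ∷
  (# 4 ∷ # 2 ∷ # 3 ∷ # 5 ∷ # 1 ∷ # 0 ∷ []) ∷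
  (# 4 ∷ # 2 ∷ # 5 ∷ # 0 ∷ # 1 ∷ # 3 ∷ []) ∷
  (# 4 ∷ # 2 ∷ # 5 ∷ # 1 ∷ # 3 ∷ # 0 ∷ []) ∷
  (# 4 ∷ # 3 ∷ # 0 ∷ # 2 ∷ # 5 ∷ # 1 ∷ []) ∷
  (# 4 ∷ # 3 ∷ # 0 ∷ # 5 ∷ # 1 ∷ # 2 ∷ []) ∷
  (# 4 ∷ # 3 ∷ # 1 ∷ # 0 ∷ # 5 ∷ # 2 ∷ []) ∷
  (# 4 ∷ # 3 ∷ # 1 ∷ # 5 ∷ # 2 ∷ # 0 ∷ []) ∷
  (# 4 ∷ # 3 ∷ # 5 ∷ # 0 ∷ # 2 ∷ # 1 ∷ []) ∷
  (# 4 ∷ # 3 ∷ # 5 ∷ # 2 ∷ # 1 ∷ # 0 ∷ []) ∷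
  (# 4 ∷ # 5 ∷ # 0 ∷ # 1 ∷ # 3 ∷ # 2 ∷ []) ∷
  (# 4 ∷ # 5 ∷ # 0 ∷ # 2 ∷ # 1 ∷ # 3 ∷ []) ∷
  (# 4 ∷ # 5 ∷ # 1 ∷ # 0 ∷ # 2 ∷ # 3 ∷ []) ∷
  (# 4 ∷ # 5 ∷ # 1 ∷ # 2 ∷ # 3 ∷ # 0 ∷ []) ∷
  (# 4 ∷ # 5 ∷ # 3 ∷ # 0 ∷ # 1 ∷ # 2 ∷ []) ∷
  (# 4 ∷ # 5 ∷ # 3 ∷ # 1 ∷ # 2 ∷ # 0 ∷ []) ∷
  (# 5 ∷ # 0 ∷ # 1 ∷ # 2 ∷ # 3 ∷ # 4 ∷ []) ∷
  (# 5 ∷ # 0 ∷ # 1 ∷ # 4 ∷ # 2 ∷ # 3 ∷ []) ∷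
  (# 5 ∷ # 0 ∷ # 3 ∷ # 1 ∷ # 2 ∷ # 4 ∷ []) ∷
  (# 5 ∷ # 0 ∷ # 3 ∷ # 4 ∷ # 1 ∷ # 2 ∷ []) ∷
  (# 5 ∷ # 0 ∷ # 4 ∷ # 1 ∷ # 3 ∷ # 2 ∷ []) ∷
  (# 5 ∷ # 0 ∷ # 4 ∷ # 2 ∷ # 1 ∷ # 3 ∷ []) ∷
  (# 5 ∷ # 2 ∷ # 0 ∷ # 1 ∷ # 3 ∷ # 4 ∷ []) ∷
  (# 5 ∷ # 2 ∷ # 0 ∷ # 4 ∷ # 1 ∷ # 3 ∷ []) ∷
  (# 5 ∷ # 2 ∷ # 3 ∷ # 0 ∷ # 1 ∷ # 4 ∷ []) ∷
  (# 5 ∷ # 2 ∷ # 3 ∷ # 4 ∷ # 0 ∷ # 1 ∷ []) ∷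
  (# 5 ∷ # 2 ∷ # 4 ∷ # 0 ∷ # 3 ∷ # 1 ∷ []) ∷
  (# 5 ∷ # 2 ∷ # 4 ∷ # 1 ∷ # 0 ∷ # 3 ∷ []) ∷
  (# 5 ∷ # 3 ∷ # 0 ∷ # 2 ∷ # 1 ∷ # 4 ∷ []) ∷
  (# 5 ∷ # 3 ∷ # 0 ∷ # 4 ∷ # 2 ∷ # 1 ∷ []) ∷
  (# 5 ∷ # 3 ∷ # 1 ∷ # 0 ∷ # 2 ∷ # 4 ∷ []) ∷
  (# 5 ∷ # 3 ∷ # 1 ∷ # 4 ∷ # 0 ∷ # 2 ∷ []) ∷
  (# 5 ∷ # 3 ∷ # 4 ∷ # 0 ∷ # 1 ∷ # 2 ∷ []) ∷
  (# 5 ∷ # 3 ∷ # 4 ∷ # 2 ∷ # 0 ∷ # 1 ∷ []) ∷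
  (# 5 ∷ # 4 ∷ # 0 ∷ # 1 ∷ # 2 ∷ # 3 ∷ []) ∷
  (# 5 ∷ # 4 ∷ # 0 ∷ # 2 ∷ # 3 ∷ # 1 ∷ []) ∷
  (# 5 ∷ # 4 ∷ # 1 ∷ # 0 ∷ # 3 ∷ # 2 ∷ []) ∷
  (# 5 ∷ # 4 ∷ # 1 ∷ # 2 ∷ # 0 ∷ # 3 ∷ []) ∷
  (# 5 ∷ # 4 ∷ # 3 ∷ # 0 ∷ # 2 ∷ # 1 ∷ []) ∷
  (# 5 ∷ # 4 ∷ # 3 ∷ # 1 ∷ # 0 ∷ # 2 ∷ []) ∷
  []

goodCompletions : Table 6 → List (Table 6)
goodCompletions π = filterᵇ (λ c → twoOrbitsᵇ ((π !_) ∘ (c !_))) cyclicTables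

oneOrbitAfterᵇ : Table 6 → Table 6 → Bool
oneOrbitAfterᵇ π a = oneOrbitᵇ ((π !_) ∘ (a !_))

-- π ∘ a is odd for every 6-cycle a when π is even, and an odd permutation of six points with at most two
-- cycles is a 6-cycle; hence the second conjunct.
completionsOKᵇ : Table 6 → List (Table 6) → Bool
completionsOKᵇ π good =
  (32 ≤ᵇ length good) ∧ (not (any (oneOrbitAfterᵇ π) cyclicTables) ∨ allᵇ (oneOrbitAfterᵇ π) good)

completionsᵇ : Table 6 → Bool
completionsᵇ π = not (injectiveᵇ (π !_)) ∨ completionsOKᵇ π (goodCompletions π)

dart==ᵇ : Dart n → Dart n → Bool
dart==ᵇ (a , b) (c , d) = (a == c) ∧ (b == d)

dart==ᵇ⇒≡ : {d e : Dart n} → T (dart==ᵇ d e) → d ≡ e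
dart==ᵇ⇒≡ {d = a , b} {c , d} t = let p , q = Equivalence.to (T-∧ {a == c}) t in cong₂ _,_ (==⇒≡ p) (==⇒≡ q)

dartsCoveredᵇ : ℕ → (Dart n → Dart n) → Dart n → Dart n → Bool
dartsCoveredᵇ {n} fuel f r₁ r₂ =
  allᵇ (λ u → allᵇ (λ w → (u == w) ∨ reachesWithin fuel f (λ d → dart==ᵇ d r₁ ∨ dart==ᵇ d r₂) (u , w)) (allFin n)) (allFin n)

dartsCoveredᵇ-sound : ∀ fuel {f : Dart n → Dart n} {r₁ r₂} → dartsCoveredᵇ fuel f r₁ r₂ ≡ true → OrbitsCover₂ f IsDart
dartsCoveredᵇ-sound {n} fuel {f} {r₁} {r₂} eq = r₁ , r₂ , cover
  where
  cover : ∀ d → IsDart d → Reach f d r₁ ⊎ Reach f d r₂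
  cover (u , w) u≢w
    with Equivalence.to (T-∨ {u == w}) (all-allFin (all-allFin (Equivalence.from T-≡ eq) u) w)
  ... | inj₁ u==w  = ⊥-elim (u≢w (==⇒≡ u==w))
  ... | inj₂ reach with j , hit ← reachesWithin-sound fuel reach =
    [ (λ h → inj₁ (j , dart==ᵇ⇒≡ h)) , (λ h → inj₂ (j , dart==ᵇ⇒≡ h)) ]
      (Equivalence.to (T-∨ {dart==ᵇ (iter f j (u , w)) r₁}) hit)

allTables-completions : allVecᵇ 6 completionsᵇ ≡ true
allTables-completions = refl

evaluates : {b : Bool} → b ≡ true → T b
evaluates = Equivalence.from T-≡

isCyclicᵇ : Table n → Bool
isCyclicᵇ t = injectiveᵇ (t !_) ∧ oneOrbitᵇ (t !_)

cyclicTablesᵇ : allᵇ isCyclicᵇ cyclicTables ≡ true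
cyclicTablesᵇ = refl

cyclicTables-cyclic : ∀ {t} → t ∈ cyclicTables → IsCyclicTable t
cyclicTables-cyclic t∈ =
  let i , o = Equivalence.to T-∧ (All.lookup (allᵇ⁺ isCyclicᵇ cyclicTables (evaluates cyclicTablesᵇ)) t∈)
  in injectiveᵇ-sound i , oneOrbitᵇ-sound o

cyclicTables-unique : Unique cyclicTables
cyclicTables-unique = from-yes (allPairs? (λ x y → ¬? (≡-dec _≟_ x y)) cyclicTables)

goodCompletions-unique : ∀ π → Unique (goodCompletions π)
goodCompletions-unique π = filter⁺ (T? ∘ λ c → twoOrbitsᵇ ((π !_) ∘ (c !_))) cyclicTables-unique

∈-goodCompletions : ∀ {π c} → c ∈ goodCompletions π → c ∈ cyclicTables × OrbitsCover₂ ((π !_) ∘ (c !_)) U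
∈-goodCompletions {π} p =
  let c∈ , t = ∈-filter⁻ (T? ∘ λ c → twoOrbitsᵇ ((π !_) ∘ (c !_))) {xs = cyclicTables} p in c∈ , twoOrbitsᵇ-sound t

∨-resolve : ∀ {a b} → T (not a ∨ b) → T a → T b
∨-resolve {true} t _ = t

module _ {π : Table 6} (π-injective : Injective _≡_ _≡_ (π !_)) where

  private
    Many Parity : Bool
    Many = 32 ≤ᵇ length (goodCompletions π)
    Parity = not (any (oneOrbitAfterᵇ π) cyclicTables) ∨ allᵇ (oneOrbitAfterᵇ π) (goodCompletions π)

    completions-OK : T Many × T Parity
    completions-OK = Equivalence.to (T-∧ {Many} {Parity})
      (∨-resolve {injectiveᵇ (π !_)} {completionsOKᵇ π (goodCompletions π)}
        (allVecᵇ-sound 6 {completionsᵇ} allTables-completions π) (injectiveᵇ-complete π-injective))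

  goodCompletions-many : 32 ≤ length (goodCompletions π)
  goodCompletions-many = ≤ᵇ⇒≤ 32 _ (proj₁ completions-OK)

  goodCompletions-parity : ∀ {a c} → a ∈ cyclicTables → OneOrbit ((π !_) ∘ (a !_)) →
                           c ∈ goodCompletions π → OneOrbit ((π !_) ∘ (c !_))
  goodCompletions-parity a∈ one c∈ = oneOrbitᵇ-sound (All.lookup (allᵇ⁺ _ (goodCompletions π) all-one) c∈)
    where
    some-one : T (any (oneOrbitAfterᵇ π) cyclicTables)
    some-one = any⁺ (oneOrbitAfterᵇ π) (lose a∈ (oneOrbitᵇ-complete (proj₁ (cyclicTables-cyclic a∈) ∘ π-injective) one))
    all-one : T (allᵇ (oneOrbitAfterᵇ π) (goodCompletions π))
    all-one = ∨-resolve {any (oneOrbitAfterᵇ π) cyclicTables} (proj₂ completions-OK) some-one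

Admissible : State 6 → Set
Admissible s = (∀ u → s u ∈ cyclicTables) × OrbitsCover₂ (faceStep (fromTables s)) IsDart

admissible-injective : ∀ {s} → Admissible s → ∀ u → Injective _≡_ _≡_ (s u !_)
admissible-injective (tables , _) u = proj₁ (cyclicTables-cyclic (tables u))

-- Opaque, so that the type checker never unfolds the options of a symbolic state.
opaque
  options : State 6 → Fin 7 → List (Table 6)
  options s v = goodCompletions (returnTable s v)

opaque
  unfolding options

  options-many : ∀ {s} → Admissible s → ∀ v → 32 ≤ length (options s v)
  options-many {s} adm v = goodCompletions-many {returnTable s v} (Surgery.returnTable-injective (admissible-injective adm) v)

  options-unique : ∀ s v → Unique (options s v)
  options-unique s v = goodCompletions-unique (returnTable s v)

  ∈-options : ∀ {s v c} → c ∈ options s v → c ∈ cyclicTables × OrbitsCover₂ ((returnTable s v !_) ∘ (c !_)) U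
  ∈-options {s} {v} = ∈-goodCompletions {returnTable s v}

  options-parity : ∀ {s v c} → Admissible s → c ∈ options s v →
                   OneOrbit ((returnTable s v !_) ∘ (s v !_)) → OneOrbit ((returnTable s v !_) ∘ (c !_))
  options-parity {s} {v} adm@(tables , _) c∈ one =
    goodCompletions-parity {returnTable s v} (Surgery.returnTable-injective (admissible-injective adm) v) (tables v) one c∈

-- Defaults to the current table when j is out of range.
choose : State 6 → Fin 7 → ℕ → State 6
choose s v j = updateAt s v (const (lookupOr (s v) (options s v) j))

choose-admissible : ∀ {s} → Admissible s → ∀ v {j} → j < length (options s v) → Admissible (choose s v j)
choose-admissible {s} adm@(tables , cover) v {j} j< =
  updateAt-const-pointwise {P = _∈ cyclicTables} s v tables (proj₁ (∈-options c∈)) ,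
  Surgery.surgery {s = s} (admissible-injective adm) v c cover (proj₂ (∈-options c∈)) (options-parity adm c∈)
  where
  c : Table 6
  c = lookupOr (s v) (options s v) j
  c∈ : c ∈ options s v
  c∈ = lookupOr-∈ (s v) (options s v) j<

choose-injective : ∀ {s} v {j j′} → j < length (options s v) → j′ < length (options s v) →
                   choose s v j v ≡ choose s v j′ v → j ≡ j′
choose-injective {s} v j< j′< eq = lookupOr-injective (s v) (options-unique s v) j< j′<
  (trans (sym (updateAt-updates v s)) (trans eq (updateAt-updates v s)))

index-bound : ∀ {s} → Admissible s → ∀ v (i : Fin 32) → toℕ i < length (options s v)
index-bound adm v i = <-≤-trans (toℕ<n i) (options-many adm v)

run : ∀ {k} → Vec (Fin 7) k → Vec (Fin 32) k → State 6 → State 6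
run []       []       s = s
run (v ∷ vs) (j ∷ js) s = run vs js (choose s v (toℕ j))

run-admissible : ∀ {k s} → Admissible s → (vs : Vec (Fin 7) k) (js : Vec (Fin 32) k) → Admissible (run vs js s)
run-admissible adm []       []       = adm
run-admissible adm (v ∷ vs) (j ∷ js) =
  run-admissible (choose-admissible adm v (index-bound adm v j)) vs js

run-untouched : ∀ {k s u} {vs : Vec (Fin 7) k} {js : Vec (Fin 32) k} → VAll.All (u ≢_) vs → run vs js s u ≡ s u
run-untouched {vs = []}     {[]}     VAll.[]          = refl
run-untouched {s = s} {u} {v ∷ vs} {j ∷ js} (u≢v VAll.∷ u∉) = trans (run-untouched u∉) (updateAt-minimal u v s u≢v)

run-injective : ∀ {k s} → Admissible s → {vs : Vec (Fin 7) k} → VUnique.Unique vs → (js js′ : Vec (Fin 32) k) →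
                (∀ u → run vs js s u ≡ run vs js′ s u) → js ≡ js′
run-injective adm []          []       []         _    = refl
run-injective {s = s} adm {v ∷ vs} (v∉ ∷ unique) (j ∷ js) (j′ ∷ js′) same
  with toℕ-injective (choose-injective v (index-bound adm v j) (index-bound adm v j′)
         (trans (sym (run-untouched {s = choose s v (toℕ j)} {vs = vs} {js} v∉))
         (trans (same v) (run-untouched {s = choose s v (toℕ j′)} {vs = vs} {js′} v∉))))
... | refl = cong (j ∷_) (run-injective (choose-admissible adm v (index-bound adm v j)) unique js js′ same)

baseTables : Vec (Table 6) 7
baseTables =
  (# 1 ∷ # 4 ∷ # 3 ∷ # 5 ∷ # 2 ∷ # 0 ∷ []) ∷
  (# 3 ∷ # 4 ∷ # 1 ∷ # 5 ∷ # 0 ∷ # 2 ∷ []) ∷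
  (# 5 ∷ # 0 ∷ # 1 ∷ # 4 ∷ # 2 ∷ # 3 ∷ []) ∷
  (# 3 ∷ # 2 ∷ # 4 ∷ # 5 ∷ # 0 ∷ # 1 ∷ []) ∷
  (# 3 ∷ # 4 ∷ # 0 ∷ # 1 ∷ # 5 ∷ # 2 ∷ []) ∷
  (# 4 ∷ # 2 ∷ # 5 ∷ # 1 ∷ # 3 ∷ # 0 ∷ []) ∷
  (# 3 ∷ # 0 ∷ # 1 ∷ # 4 ∷ # 5 ∷ # 2 ∷ []) ∷
  []

base : State 6
base = baseTables !_

baseRoot₁ baseRoot₂ : Dart 7
baseRoot₁ = zero , # 1
baseRoot₂ = zero , # 2

baseCoveredᵇ : dartsCoveredᵇ 49 (faceStep (fromTables base)) baseRoot₁ baseRoot₂ ≡ true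
baseCoveredᵇ = refl

opaque
  unfolding options

  baseOptionsᵇ : (47 ≤ᵇ length (options base zero)) ≡ true
  baseOptionsᵇ = refl

base-admissible : Admissible base
base-admissible = from-yes (all? (λ u → base u ∈? cyclicTables)) ,
                  dartsCoveredᵇ-sound 49 {faceStep (fromTables base)} {baseRoot₁} {baseRoot₂} baseCoveredᵇ

base-options : 47 ≤ length (options base zero)
base-options = ≤ᵇ⇒≤ 47 _ (evaluates baseOptionsᵇ)

digits : ∀ {b} k → Fin (b ^ k) → Vec (Fin b) k
digits         zero    i = []
digits {b = b} (suc k) i = proj₁ (remQuot {b} (b ^ k) i) ∷ digits k (proj₂ (remQuot {b} (b ^ k) i))

digits-injective : ∀ {b} k → Injective _≡_ _≡_ (digits {b} k)
digits-injective zero {zero} {zero} _ = refl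
digits-injective {b} (suc k) {i} {j} eq with head≡ , tail≡ ← ∷-injective eq =
  trans (sym (combine-remQuot {b} (b ^ k) i))
        (trans (cong₂ combine head≡ (digits-injective k tail≡)) (combine-remQuot {b} (b ^ k) j))

Choice : Set
Choice = Fin 47 × Vec (Fin 32) 6

size≤ : 49766400000 ≤ 47 * 32 ^ 6
size≤ = ≤ᵇ⇒≤ 49766400000 (47 * 32 ^ 6) _

choice : Fin 49766400000 → Choice
choice i = proj₁ r , digits {32} 6 (proj₂ r)
  where
  r : Fin 47 × Fin (32 ^ 6)
  r = remQuot {47} (32 ^ 6) (inject≤ i size≤)

choice-injective : Injective _≡_ _≡_ choice
choice-injective {i} {j} eq = inject≤-injective size≤ size≤ i j (begin
    inject≤ i size≤                                            ≡⟨ combine-remQuot {47} (32 ^ 6) _ ⟨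
    uncurry combine (remQuot {47} (32 ^ 6) (inject≤ i size≤))  ≡⟨ cong₂ combine (cong proj₁ eq) (digits-injective {32} 6 (cong proj₂ eq)) ⟩
    uncurry combine (remQuot {47} (32 ^ 6) (inject≤ j size≤))  ≡⟨ combine-remQuot {47} (32 ^ 6) _ ⟩
    inject≤ j size≤                                            ∎)
  where open ≡-Reasoning

laterVertices : Vec (Fin 7) 6
laterVertices = tabulate suc

zero∉laterVertices : VAll.All (zero ≢_) laterVertices
zero∉laterVertices = tabulate⁺ {f = suc} λ _ ()

embedding : Choice → State 6
embedding (j₀ , js) = run laterVertices js (choose base zero (toℕ j₀))

first-admissible : (j₀ : Fin 47) → Admissible (choose base zero (toℕ j₀))
first-admissible j₀ = choose-admissible base-admissible zero (<-≤-trans (toℕ<n j₀) base-options)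

embedding-admissible : ∀ x → Admissible (embedding x)
embedding-admissible (j₀ , js) = run-admissible (first-admissible j₀) laterVertices js

embedding-injective : ∀ {x y} → (∀ u → embedding x u ≡ embedding y u) → x ≡ y
embedding-injective {j₀ , js} {j₀′ , js′} same
  with toℕ-injective (choose-injective zero (<-≤-trans (toℕ<n j₀) base-options) (<-≤-trans (toℕ<n j₀′) base-options)
         (trans (sym (run-untouched {s = choose base zero (toℕ j₀)} {vs = laterVertices} {js} zero∉laterVertices))
         (trans (same zero) (run-untouched {s = choose base zero (toℕ j₀′)} {vs = laterVertices} {js′} zero∉laterVertices))))
... | refl = cong (j₀ ,_) (run-injective (first-admissible j₀) (VUniqueProps.tabulate⁺ suc-injective) js js′ same)

admissible-isMaxGenus : ∀ {s} → Admissible s → IsMaxGenusEmbedding 7 (fromTables s)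
admissible-isMaxGenus {s} (tables , cover) =
  isMaxGenus-K₇ {fromTables s} (fromTables-isRotationSystem {s = s} (cyclicTables-cyclic ∘ tables))
    (faces-≤-2 {7} {fromTables s} (faceStep-fromTables-injective {s = s} (proj₁ ∘ cyclicTables-cyclic ∘ tables)) cover)

mainTheorem11 : Σ (Fin 49766400000 → RotSys 7) λ f →
                  (∀ i → IsMaxGenusEmbedding 7 (f i)) ×
                  (∀ i j → SameRot (f i) (f j) → i ≡ j)
mainTheorem11 =
  fromTables ∘ embedding ∘ choice ,
  (λ i → admissible-isMaxGenus {embedding (choice i)} (embedding-admissible (choice i))) ,
  (λ i j same → choice-injective {i} {j}
                   (embedding-injective {choice i} {choice j} (fromTables-injective {s = embedding (choice i)} same)))
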